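{- Let $G$ be a graph, $t \in \mathbb{N}$, and $X \subseteq V(G)$. If there exist $t+1$ pairwise vertex-disjoint subgraphs $G_1,\dots,G_{t+1}$ of $G - X$ with $\mathrm{tw}(G[V(G_i) \cup X]) > 2$ for every $i$, then $X$ is a limit-$(|X|-1)$ subset for $(G,t)$.
   Context: Graphs are finite, simple, undirected; $\mathrm{tw}$ is treewidth. A solution for $(G,t)$ is a set $S \subseteq V(G)$ with $|S| \le t$ and $\mathrm{tw}(G - S) \le 2$. A set $X \subseteq V(G)$ is a limit-$m$ subset for $(G,t)$ if every solution $S$ for $(G,t)$ satisfies $|X \setminus S| \le m$. -}

module Defs where

open import Data.Nat using (ℕ; zero; suc; _≤_; _∸_)
open import Data.Fin using (Fin; zero; suc; toℕ)
open import Data.Fin.Subset using (Subset; _∈_; _∉_; _⊆_; _∪_; _─_; ∁; ∣_∣)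
open import Data.Product using (Σ; ∃; _×_; _,_)
open import Data.Sum using (_⊎_)
open import Data.Empty using (⊥)
open import Relation.Nullary using (¬_)
open import Relation.Binary.PropositionalEquality using (_≡_; _≢_)

record Graph : Set₁ where
  field
    n     : ℕ
    Adj   : Fin n → Fin n → Set
    sym   : ∀ {u v} → Adj u v → Adj v u
    irrefl : ∀ {v} → ¬ Adj v v
open Graph public

-- A (finite, nonempty) tree on the nodes Fin (suc m), presented by a parent
-- function: node (suc k) has parent (parent k), which is an earlier node.
-- Every finite tree is isomorphic to one of this form (number the nodes in
-- BFS order from a root), and every such structure is a tree.
record Tree : Set where
  field
    m        : ℕ
    parent   : Fin m → Fin (suc m)
    parent<  : ∀ k → toℕ (parent k) ≤ toℕ k

  Node : Set
  Node = Fin (suc m)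

  TAdj : Node → Node → Set
  TAdj i j = (∃ λ k → i ≡ suc k × parent k ≡ j) ⊎ (∃ λ k → j ≡ suc k × parent k ≡ i)

  data WalkIn (P : Node → Set) : Node → Node → Set where
    here : ∀ {i} → P i → WalkIn P i i
    step : ∀ {i j k} → P i → TAdj i j → WalkIn P j k → WalkIn P i k

  ConnectedIn : (Node → Set) → Set
  ConnectedIn P = ∀ i j → P i → P j → WalkIn P i j
open Tree public

record TreeDecomp (G : Graph) (U : Subset (n G)) (k : ℕ) : Set₁ where
  field
    T        : Tree
    bag      : Node T → Subset (n G)
    bag⊆U    : ∀ i → bag i ⊆ U
    covers-v : ∀ v → v ∈ U → ∃ λ i → v ∈ bag i
    covers-e : ∀ u v → u ∈ U → v ∈ U → Adj G u v →
               ∃ λ i → (u ∈ bag i × v ∈ bag i)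
    coherent : ∀ v → ConnectedIn T (λ i → v ∈ bag i)
    width    : ∀ i → ∣ bag i ∣ ≤ suc k

twInduced≤ : (G : Graph) → Subset (n G) → ℕ → Set₁
twInduced≤ G U k = TreeDecomp G U k

Solution : (G : Graph) → ℕ → Subset (n G) → Set₁
Solution G t S = ∣ S ∣ ≤ t × twInduced≤ G (∁ S) 2

LimitSubset : (G : Graph) → ℕ → ℕ → Subset (n G) → Set₁
LimitSubset G t lim X = ∀ S → Solution G t S → ∣ X ─ S ∣ ≤ lim

{-# OPTIONS --safe #-}
-- If a solution S meets X it already removes a vertex of X.  Otherwise S
-- must meet every Vᵢ, since Vᵢ ∪ X ⊆ V(G) ∖ S would make tw(G[Vᵢ ∪ X]) ≤ 2
-- (treewidth is monotone under induced subgraphs); but t + 1 pairwise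
-- disjoint sets cannot all be met by a set of size at most t.
module Submission where

open import Defs
open import Data.Nat using (ℕ; suc; _∸_; _≤_)
open import Data.Nat.Properties using (<⇒≤pred; ≤-trans; 1+n≰n)
open import Data.Fin using (Fin; zero; suc; _≟_)
open import Data.Fin.Properties using (all?; ¬∀⟶∃¬; injective⇒≤; suc-injective)
open import Data.Fin.Subset
  using (Subset; _∈_; _∉_; _⊆_; _∪_; _∩_; ∁; ∣_∣; inside; outside; Nonempty; Empty)
open import Data.Fin.Subset.Properties
  using (nonempty?; x∈p∩q⁺; x∈p∩q⁻; ∣p∩q∣≤∣p∣; p∩q≢∅⇒∣p─q∣<∣p∣; x∈p∪q⁻; x∉p⇒x∈∁p)
open import Data.Vec.Base using (_∷_; here; there)
open import Data.Product using (_×_; _,_; proj₁; proj₂)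
open import Data.Sum using ([_,_])
open import Data.Empty using (⊥-elim)
open import Relation.Nullary using (¬_; yes; no)
open import Relation.Binary.PropositionalEquality using (_≢_; _≡_; refl; cong; subst)

WalkIn-map : ∀ (T : Tree) {P Q : Node T → Set} → (∀ {x} → P x → Q x) →
             ∀ {i j} → WalkIn T P i j → WalkIn T Q i j
WalkIn-map T f (here p)     = here (f p)
WalkIn-map T f (step p e w) = step (f p) e (WalkIn-map T f w)

TreeDecomp-restrict : ∀ {G U U′ k} → TreeDecomp G U′ k → U ⊆ U′ → TreeDecomp G U k
TreeDecomp-restrict {G} {U} {U′} {k} td U⊆U′ = record
  { T        = T
  ; bag      = λ i → bag i ∩ U
  ; bag⊆U    = λ i x∈ → proj₂ (x∈p∩q⁻ (bag i) U x∈)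
  ; covers-v = λ v v∈U → let (i , v∈bag) = covers-v v (U⊆U′ v∈U) in
      i , x∈p∩q⁺ (v∈bag , v∈U)
  ; covers-e = λ u v u∈U v∈U uv → let (i , u∈bag , v∈bag) = covers-e u v (U⊆U′ u∈U) (U⊆U′ v∈U) uv in
      i , x∈p∩q⁺ (u∈bag , u∈U) , x∈p∩q⁺ (v∈bag , v∈U)
  ; coherent = λ v i j v∈i v∈j →
      let (v∈bag-i , v∈U) = x∈p∩q⁻ (bag i) U v∈i in
      WalkIn-map T (λ v∈bag → x∈p∩q⁺ (v∈bag , v∈U))
        (coherent v i j v∈bag-i (proj₁ (x∈p∩q⁻ (bag j) U v∈j)))
  ; width    = λ i → ≤-trans (∣p∩q∣≤∣p∣ (bag i) U) (width i)
  }
  where open TreeDecomp td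

position : ∀ {m} (S : Subset m) v → v ∈ S → Fin ∣ S ∣
position (inside  ∷ S) zero    here      = zero
position (inside  ∷ S) (suc v) (there p) = suc (position S v p)
position (outside ∷ S) (suc v) (there p) = position S v p

position-injective : ∀ {m} (S : Subset m) {u v} (p : u ∈ S) (q : v ∈ S) →
                     position S u p ≡ position S v q → u ≡ v
position-injective (inside  ∷ S) here      here      _  = refl
position-injective (inside  ∷ S) (there p) (there q) eq = cong suc (position-injective S p q (suc-injective eq))
position-injective (outside ∷ S) (there p) (there q) eq = cong suc (position-injective S p q eq)

injective-into⇒≤∣∣ : ∀ {k m} (S : Subset m) (f : Fin k → Fin m) (f∈S : ∀ i → f i ∈ S) →
                     (∀ {i j} → f i ≡ f j → i ≡ j) → k ≤ ∣ S ∣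
injective-into⇒≤∣∣ S f f∈S f-inj =
  injective⇒≤ {f = λ i → position S (f i) (f∈S i)}
              (λ eq → f-inj (position-injective S (f∈S _) (f∈S _) eq))

meets-disjoint⇒≤∣∣ : ∀ {k m} (S : Subset m) (Vs : Fin k → Subset m) →
                     (∀ i j → i ≢ j → ∀ v → v ∈ Vs i → v ∉ Vs j) →
                     (∀ i → Nonempty (Vs i ∩ S)) → k ≤ ∣ S ∣
meets-disjoint⇒≤∣∣ S Vs disjoint meets = injective-into⇒≤∣∣ S w (λ i → proj₂ (w∈ i)) w-injective
  where
  w : Fin _ → Fin _
  w i = proj₁ (meets i)

  w∈ : ∀ i → w i ∈ Vs i × w i ∈ S
  w∈ i = x∈p∩q⁻ (Vs i) S (proj₂ (meets i))

  w-injective : ∀ {i j} → w i ≡ w j → i ≡ j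
  w-injective {i} {j} eq with i ≟ j
  ... | yes i≡j = i≡j
  ... | no  i≢j = ⊥-elim (disjoint i j i≢j (w j) (subst (_∈ Vs i) eq (proj₁ (w∈ i))) (proj₁ (w∈ j)))

missing⇒⊆∁ : ∀ {m} (p S : Subset m) → Empty (p ∩ S) → p ⊆ ∁ S
missing⇒⊆∁ p S p∩S=∅ x∈p = x∉p⇒x∈∁p (λ x∈S → p∩S=∅ (_ , x∈p∩q⁺ (x∈p , x∈S)))

∪-⊆ : ∀ {m} {p q r : Subset m} → p ⊆ r → q ⊆ r → p ∪ q ⊆ r
∪-⊆ {p = p} {q} p⊆r q⊆r x∈ = [ p⊆r , q⊆r ] (x∈p∪q⁻ p q x∈)

lemma4p2 : (G : Graph) (t : ℕ) (X : Subset (n G))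
    → (Vs : Fin (suc t) → Subset (n G))
    → (∀ i → Vs i ⊆ ∁ X)
    → (∀ i j → i ≢ j → ∀ v → v ∈ Vs i → v ∉ Vs j)
    → (∀ i → ¬ twInduced≤ G (Vs i ∪ X) 2)
    → LimitSubset G t (∣ X ∣ ∸ 1) X
lemma4p2 G t X Vs _ disjoint high-tw S (∣S∣≤t , td) with nonempty? (X ∩ S)
... | yes X∩S≠∅ = <⇒≤pred (p∩q≢∅⇒∣p─q∣<∣p∣ X S X∩S≠∅)
... | no  X∩S=∅ with all? (λ i → nonempty? (Vs i ∩ S))
...   | yes meets = ⊥-elim (1+n≰n (≤-trans (meets-disjoint⇒≤∣∣ S Vs disjoint meets) ∣S∣≤t))
...   | no ¬meets =
  let (i , Vᵢ∩S=∅) = ¬∀⟶∃¬ _ _ (λ i → nonempty? (Vs i ∩ S)) ¬meets in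
  ⊥-elim (high-tw i (TreeDecomp-restrict td (∪-⊆ (missing⇒⊆∁ (Vs i) S Vᵢ∩S=∅) (missing⇒⊆∁ X S X∩S=∅))))
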